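{- Let $G$ be a graph and let $W,V_1,\dots,V_r$ be pairwise disjoint subsets of $V(G)$ such that $W\cup\bigcup_{i=1}^rV_i=V(G)$, $r\ge2$, and $\min\{|V_1|,\dots,|V_r|\}\ge2$. If $G[W\cup V_i\cup V_j]$ is prime for all distinct $i,j\in\{1,\dots,r\}$, then $G$ is prime.
   Context: Graphs are finite and simple; $G[X]$ is the induced subgraph on $X$. A split of a graph is a partition $(A,B)$ of its vertex set with $\min\{|A|,|B|\}\ge2$ such that for some $A'\subseteq A$, $B'\subseteq B$, vertices $x\in A$, $y\in B$ are adjacent iff $x\in A'$ and $y\in B'$; a graph is prime if it has no split. -}

module Defs where

open import Data.Nat using (ℕ; _≤_)
open import Data.Bool using (Bool; true; false)
open import Data.Fin using (Fin)
open import Data.Fin.Subset using (Subset; _∈_; _∉_; _⊆_; ∣_∣; _∪_; ⊤)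
open import Data.Product using (Σ; _×_; ∃)
open import Data.Sum using (_⊎_)
open import Relation.Nullary using (¬_)
open import Relation.Binary.PropositionalEquality using (_≡_; _≢_)
open import Function.Bundles using (_⇔_)

record Graph (n : ℕ) : Set where
  field
    adj    : Fin n → Fin n → Bool
    sym    : ∀ x y → adj x y ≡ adj y x
    irrefl : ∀ x → adj x x ≡ false

open Graph public

Adjacent : ∀ {n} → Graph n → Fin n → Fin n → Set
Adjacent G x y = adj G x y ≡ true

Disjoint : ∀ {n} → Subset n → Subset n → Set
Disjoint {n} A B = (x : Fin n) → x ∈ A → x ∉ B

-- (A , B) is a split of the induced subgraph G[X]:
-- a partition of X = V(G[X]) into A and B with |A|,|B| ≥ 2, and subsets
-- A' ⊆ A, B' ⊆ B such that x ∈ A, y ∈ B are adjacent iff x ∈ A' and y ∈ B'.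
-- (Adjacency in G[X] between vertices of X is adjacency in G.)
IsSplit : ∀ {n} → Graph n → Subset n → Subset n → Subset n → Set
IsSplit G X A B =
  Disjoint A B × (A ∪ B ≡ X) × (2 ≤ ∣ A ∣) × (2 ≤ ∣ B ∣) ×
  Σ (Subset _) λ A' → Σ (Subset _) λ B' → A' ⊆ A × B' ⊆ B ×
    (∀ x y → x ∈ A → y ∈ B → (Adjacent G x y ⇔ (x ∈ A' × y ∈ B')))

PrimeInduced : ∀ {n} → Graph n → Subset n → Set
PrimeInduced G X = ¬ (Σ (Subset _) λ A → Σ (Subset _) λ B → IsSplit G X A B)

Prime : ∀ {n} → Graph n → Set
Prime G = PrimeInduced G ⊤

{-# OPTIONS --safe #-}
-- A split (A , B) of G restricts to a split of G[W ∪ V i ∪ V j] as soon as A and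
-- B both keep two vertices there, so it suffices to find such i ≢ j. Each class
-- V k has two vertices in A, or two in B, or meets both; two classes meeting both
-- sides form such a pair. If V i has two vertices in A, pair i with a class
-- holding the two B-vertices outside W ∪ V i; if these lie in different classes,
-- either one of them has two vertices in B and is paired with i, or both meet A
-- and are paired with each other. Two vertices in B is the symmetric case.
module Submission where

open import Defs hiding (sym)
open import Data.Nat using (ℕ; _≤_; _<_; s≤s; z≤n)
open import Data.Nat.Properties using (≤-<-trans)
open import Data.Fin using (Fin; zero; suc)
open import Data.Fin.Properties using (_≟_; suc-injective)
open import Data.Fin.Subset
  using (Subset; _∈_; ∣_∣; _∪_; _∩_; _⊆_; Nonempty; inside; outside)
open import Data.Fin.Subset.Properties
  using (x∈p∪q⁺; x∈p∪q⁻; x∈p∩q⁺; x∈p∩q⁻; p∩q⊆p; p∩q⊆q; ⊆-antisym; ⊆⊤; ∈⊤;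
         ∩-distribʳ-∪; x∈p⇒∣p-x∣<∣p∣; x∈p∧x≢y⇒x∈p-y)
open import Data.Vec using (_∷_; here; there)
open import Data.Product using (∃; ∃₂; _×_; _,_; proj₂)
open import Data.Sum using (_⊎_; inj₁; inj₂)
import Data.Sum as Sum
open import Function using (_∘_)
open import Function.Bundles using (_⇔_; mk⇔; Equivalence)
open import Relation.Nullary using (yes; no)
open import Relation.Binary.PropositionalEquality
  using (_≡_; _≢_; refl; cong; sym; subst; module ≡-Reasoning)

record TwoElements {n} (p : Subset n) : Set where
  constructor twoElements
  field
    {first second} : Fin n
    first≢second   : first ≢ second
    first∈         : first ∈ p
    second∈        : second ∈ p

TwoElements-mono : ∀ {n} {p q : Subset n} → p ⊆ q → TwoElements p → TwoElements q
TwoElements-mono p⊆q (twoElements x≢y x∈p y∈p) = twoElements x≢y (p⊆q x∈p) (p⊆q y∈p)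

TwoElements-∩⁺ : ∀ {n} {p q : Subset n} {x y} →
  x ≢ y → x ∈ p × x ∈ q → y ∈ p × y ∈ q → TwoElements (p ∩ q)
TwoElements-∩⁺ x≢y x∈p∩q y∈p∩q = twoElements x≢y (x∈p∩q⁺ x∈p∩q) (x∈p∩q⁺ y∈p∩q)

TwoElements-restrict : ∀ {n} {p q : Subset n} (two : TwoElements p) →
  TwoElements.first two ∈ q → TwoElements.second two ∈ q → TwoElements (p ∩ q)
TwoElements-restrict (twoElements x≢y x∈p y∈p) x∈q y∈q =
  TwoElements-∩⁺ x≢y (x∈p , x∈q) (y∈p , y∈q)

x∈p⇒0<∣p∣ : ∀ {n} {x : Fin n} {p : Subset n} → x ∈ p → 0 < ∣ p ∣
x∈p⇒0<∣p∣ x∈p = ≤-<-trans z≤n (x∈p⇒∣p-x∣<∣p∣ x∈p)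

TwoElements⇒2≤∣p∣ : ∀ {n} {p : Subset n} → TwoElements p → 2 ≤ ∣ p ∣
TwoElements⇒2≤∣p∣ (twoElements x≢y x∈p y∈p) =
  ≤-<-trans (x∈p⇒0<∣p∣ (x∈p∧x≢y⇒x∈p-y y∈p (x≢y ∘ sym))) (x∈p⇒∣p-x∣<∣p∣ x∈p)

0<∣p∣⇒Nonempty : ∀ {n} (p : Subset n) → 0 < ∣ p ∣ → Nonempty p
0<∣p∣⇒Nonempty (inside ∷ p) _ = zero , here
0<∣p∣⇒Nonempty (outside ∷ p) 0<∣p∣ =
  let (x , x∈p) = 0<∣p∣⇒Nonempty p 0<∣p∣ in suc x , there x∈p

2≤∣p∣⇒TwoElements : ∀ {n} (p : Subset n) → 2 ≤ ∣ p ∣ → TwoElements p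
2≤∣p∣⇒TwoElements (inside ∷ p) (s≤s 0<∣p∣) =
  twoElements (λ ()) here (there (proj₂ (0<∣p∣⇒Nonempty p 0<∣p∣)))
2≤∣p∣⇒TwoElements (outside ∷ p) 2≤∣p∣ =
  let twoElements x≢y x∈p y∈p = 2≤∣p∣⇒TwoElements p 2≤∣p∣
  in twoElements (x≢y ∘ suc-injective) (there x∈p) (there y∈p)

∩-monoˡ-⊆ : ∀ {n} {p q : Subset n} (r : Subset n) → p ⊆ q → p ∩ r ⊆ q ∩ r
∩-monoˡ-⊆ {p = p} r p⊆q x∈p∩r =
  let (x∈p , x∈r) = x∈p∩q⁻ p r x∈p∩r in x∈p∩q⁺ (p⊆q x∈p , x∈r)

∩-monoʳ-⊆ : ∀ {n} {q r : Subset n} (p : Subset n) → q ⊆ r → p ∩ q ⊆ p ∩ r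
∩-monoʳ-⊆ {q = q} p q⊆r x∈p∩q =
  let (x∈p , x∈q) = x∈p∩q⁻ p q x∈p∩q in x∈p∩q⁺ (x∈p , q⊆r x∈q)

p⊆q⇒q∩p≡p : ∀ {n} {p q : Subset n} → p ⊆ q → q ∩ p ≡ p
p⊆q⇒q∩p≡p {p = p} {q} p⊆q = ⊆-antisym (p∩q⊆q q p) (λ x∈p → x∈p∩q⁺ (p⊆q x∈p , x∈p))

split-restrict : ∀ {n} {G : Graph n} {Y A B X : Subset n} → IsSplit G Y A B → X ⊆ Y →
  2 ≤ ∣ A ∩ X ∣ → 2 ≤ ∣ B ∩ X ∣ → IsSplit G X (A ∩ X) (B ∩ X)
split-restrict {G = G} {Y} {A} {B} {X}
  (A#B , A∪B≡Y , _ , _ , A' , B' , A'⊆A , B'⊆B , adj⇔) X⊆Y 2≤∣A∩X∣ 2≤∣B∩X∣ =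
  disjoint , union , 2≤∣A∩X∣ , 2≤∣B∩X∣ ,
  A' ∩ X , B' ∩ X , ∩-monoˡ-⊆ X A'⊆A , ∩-monoˡ-⊆ X B'⊆B , adj⇔X
  where
  disjoint : Disjoint (A ∩ X) (B ∩ X)
  disjoint x x∈A∩X x∈B∩X = A#B x (p∩q⊆p A X x∈A∩X) (p∩q⊆p B X x∈B∩X)

  union : (A ∩ X) ∪ (B ∩ X) ≡ X
  union = begin
    (A ∩ X) ∪ (B ∩ X) ≡⟨ sym (∩-distribʳ-∪ X A B) ⟩
    (A ∪ B) ∩ X       ≡⟨ cong (_∩ X) A∪B≡Y ⟩
    Y ∩ X             ≡⟨ p⊆q⇒q∩p≡p X⊆Y ⟩
    X                 ∎
    where open ≡-Reasoning

  adj⇔X : ∀ x y → x ∈ A ∩ X → y ∈ B ∩ X → Adjacent G x y ⇔ (x ∈ A' ∩ X × y ∈ B' ∩ X)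
  adj⇔X x y x∈A∩X y∈B∩X = mk⇔
    (λ xy → let (x∈A' , y∈B') = Equivalence.to adj⇔xy xy
            in x∈p∩q⁺ (x∈A' , x∈X) , x∈p∩q⁺ (y∈B' , y∈X))
    (λ (x∈A'∩X , y∈B'∩X) → Equivalence.from adj⇔xy (p∩q⊆p A' X x∈A'∩X , p∩q⊆p B' X y∈B'∩X))
    where
    x∈X = p∩q⊆q A X x∈A∩X
    y∈X = p∩q⊆q B X y∈B∩X
    adj⇔xy = adj⇔ x y (p∩q⊆p A X x∈A∩X) (p∩q⊆p B X y∈B∩X)

Covering : ∀ {n} → Subset n → Subset n → Set
Covering {n} S T = (v : Fin n) → v ∈ S ⊎ v ∈ T

anotherIndex : ∀ {r} → 2 ≤ r → (i : Fin r) → ∃ λ j → i ≢ j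
anotherIndex (s≤s (s≤s _)) zero    = suc zero , λ ()
anotherIndex (s≤s (s≤s _)) (suc _) = zero , λ ()

module Pieces {n r : ℕ} (W : Subset n) (V : Fin r → Subset n)
  (V-disjoint : ∀ i j → i ≢ j → Disjoint (V i) (V j))
  (covers : ∀ v → v ∈ W ⊎ ∃ λ i → v ∈ V i)
  (V-two : ∀ i → TwoElements (V i))
  (another : (i : Fin r) → ∃ λ j → i ≢ j) where

  Piece : Fin r → Fin r → Subset n
  Piece i j = W ∪ (V i ∪ V j)

  W⊆Piece : ∀ {i j} → W ⊆ Piece i j
  W⊆Piece x∈W = x∈p∪q⁺ (inj₁ x∈W)

  Vˡ⊆Piece : ∀ {i j} → V i ⊆ Piece i j
  Vˡ⊆Piece x∈Vi = x∈p∪q⁺ (inj₂ (x∈p∪q⁺ (inj₁ x∈Vi)))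

  Vʳ⊆Piece : ∀ {i j} → V j ⊆ Piece i j
  Vʳ⊆Piece x∈Vj = x∈p∪q⁺ (inj₂ (x∈p∪q⁺ (inj₂ x∈Vj)))

  BalancedPiece : Subset n → Subset n → Set
  BalancedPiece S T =
    ∃₂ λ i j → i ≢ j × TwoElements (S ∩ Piece i j) × TwoElements (T ∩ Piece i j)

  BalancedPiece-swap : ∀ {S T} → BalancedPiece S T → BalancedPiece T S
  BalancedPiece-swap (i , j , i≢j , twoS , twoT) = i , j , i≢j , twoT , twoS

  locate : ∀ i y → (∀ j → y ∈ Piece i j) ⊎ ∃ λ k → i ≢ k × y ∈ V k
  locate i y with covers y
  ... | inj₁ y∈W = inj₁ λ _ → W⊆Piece y∈W
  ... | inj₂ (k , y∈Vk) with i ≟ k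
  ...   | yes refl = inj₁ λ _ → Vˡ⊆Piece y∈Vk
  ...   | no i≢k   = inj₂ (k , i≢k , y∈Vk)

  meetsBoth⇒TwoElements : ∀ {S i j} → i ≢ j → Nonempty (S ∩ V i) → Nonempty (S ∩ V j) →
    TwoElements (S ∩ Piece i j)
  meetsBoth⇒TwoElements {S} {i} {j} i≢j (x , x∈S∩Vi) (y , y∈S∩Vj) =
    twoElements x≢y (∩-monoʳ-⊆ S Vˡ⊆Piece x∈S∩Vi) (∩-monoʳ-⊆ S Vʳ⊆Piece y∈S∩Vj)
    where
    x≢y : x ≢ y
    x≢y refl = V-disjoint i j i≢j x (p∩q⊆q S (V i) x∈S∩Vi) (p∩q⊆q S (V j) y∈S∩Vj)

  classProfile : ∀ {S T} → Covering S T → ∀ k →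
    TwoElements (S ∩ V k) ⊎ TwoElements (T ∩ V k) ⊎
    (Nonempty (S ∩ V k) × Nonempty (T ∩ V k))
  classProfile S∪T k with V-two k
  ... | twoElements {u} {u'} u≢u' u∈ u'∈ with S∪T u | S∪T u'
  ...   | inj₁ u∈S | inj₁ u'∈S =
          inj₁ (TwoElements-∩⁺ u≢u' (u∈S , u∈) (u'∈S , u'∈))
  ...   | inj₂ u∈T | inj₂ u'∈T =
          inj₂ (inj₁ (TwoElements-∩⁺ u≢u' (u∈T , u∈) (u'∈T , u'∈)))
  ...   | inj₁ u∈S | inj₂ u'∈T =
          inj₂ (inj₂ ((u , x∈p∩q⁺ (u∈S , u∈)) , (u' , x∈p∩q⁺ (u'∈T , u'∈))))
  ...   | inj₂ u∈T | inj₁ u'∈S =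
          inj₂ (inj₂ ((u' , x∈p∩q⁺ (u'∈S , u'∈)) , (u , x∈p∩q⁺ (u∈T , u∈))))

  meetsOrTwoElements : ∀ {S T} → Covering S T → ∀ k →
    Nonempty (S ∩ V k) ⊎ TwoElements (T ∩ V k)
  meetsOrTwoElements S∪T k with classProfile S∪T k
  ... | inj₁ twoS                = inj₁ (_ , TwoElements.first∈ twoS)
  ... | inj₂ (inj₁ twoT)         = inj₂ twoT
  ... | inj₂ (inj₂ (meetsS , _)) = inj₁ meetsS

  pairUp : ∀ {S T i j} → i ≢ j → TwoElements (S ∩ V i) → TwoElements (T ∩ Piece i j) →
    BalancedPiece S T
  pairUp {S} {i = i} {j} i≢j twoS twoT =
    i , j , i≢j , TwoElements-mono (∩-monoʳ-⊆ S Vˡ⊆Piece) twoS , twoT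

  balancedPieceAt : ∀ {S T} → Covering S T → ∀ i → TwoElements (S ∩ V i) → TwoElements T →
    BalancedPiece S T
  balancedPieceAt {T = T} S∪T i twoS twoT@(twoElements {y₁} {y₂} _ y₁∈T y₂∈T)
    with locate i y₁ | locate i y₂
  ... | inj₁ y₁∈ | inj₁ y₂∈ =
    let (j , i≢j) = another i in pairUp i≢j twoS (TwoElements-restrict twoT (y₁∈ j) (y₂∈ j))
  ... | inj₁ y₁∈ | inj₂ (k , i≢k , y₂∈Vk) =
    pairUp i≢k twoS (TwoElements-restrict twoT (y₁∈ k) (Vʳ⊆Piece y₂∈Vk))
  ... | inj₂ (k , i≢k , y₁∈Vk) | inj₁ y₂∈ =
    pairUp i≢k twoS (TwoElements-restrict twoT (Vʳ⊆Piece y₁∈Vk) (y₂∈ k))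
  ... | inj₂ (k₁ , i≢k₁ , y₁∈Vk₁) | inj₂ (k₂ , i≢k₂ , y₂∈Vk₂)
    with k₁ ≟ k₂ | meetsOrTwoElements S∪T k₁ | meetsOrTwoElements S∪T k₂
  ...   | yes refl | _ | _ =
          pairUp i≢k₁ twoS (TwoElements-restrict twoT (Vʳ⊆Piece y₁∈Vk₁) (Vʳ⊆Piece y₂∈Vk₂))
  ...   | no _ | inj₂ twoT₁ | _ =
          pairUp i≢k₁ twoS (TwoElements-mono (∩-monoʳ-⊆ T Vʳ⊆Piece) twoT₁)
  ...   | no _ | inj₁ _ | inj₂ twoT₂ =
          pairUp i≢k₂ twoS (TwoElements-mono (∩-monoʳ-⊆ T Vʳ⊆Piece) twoT₂)
  ...   | no k₁≢k₂ | inj₁ meetsS₁ | inj₁ meetsS₂ =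
          k₁ , k₂ , k₁≢k₂ , meetsBoth⇒TwoElements k₁≢k₂ meetsS₁ meetsS₂ ,
          meetsBoth⇒TwoElements k₁≢k₂
            (y₁ , x∈p∩q⁺ (y₁∈T , y₁∈Vk₁)) (y₂ , x∈p∩q⁺ (y₂∈T , y₂∈Vk₂))

  balancedPiece : ∀ {S T} → Covering S T → TwoElements S → TwoElements T → Fin r →
    BalancedPiece S T
  balancedPiece S∪T twoS twoT i₀ with another i₀
  ... | i₁ , i₀≢i₁ with classProfile S∪T i₀ | classProfile S∪T i₁
  ...   | inj₁ twoS₀ | _ = balancedPieceAt S∪T i₀ twoS₀ twoT
  ...   | inj₂ (inj₁ twoT₀) | _ =
          BalancedPiece-swap (balancedPieceAt (Sum.swap ∘ S∪T) i₀ twoT₀ twoS)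
  ...   | inj₂ (inj₂ _) | inj₁ twoS₁ = balancedPieceAt S∪T i₁ twoS₁ twoT
  ...   | inj₂ (inj₂ _) | inj₂ (inj₁ twoT₁) =
          BalancedPiece-swap (balancedPieceAt (Sum.swap ∘ S∪T) i₁ twoT₁ twoS)
  ...   | inj₂ (inj₂ (meetsS₀ , meetsT₀)) | inj₂ (inj₂ (meetsS₁ , meetsT₁)) =
          i₀ , i₁ , i₀≢i₁ , meetsBoth⇒TwoElements i₀≢i₁ meetsS₀ meetsS₁ ,
          meetsBoth⇒TwoElements i₀≢i₁ meetsT₀ meetsT₁

lemma6p5 : ∀ {n r : ℕ} (G : Graph n) (W : Subset n) (V : Fin r → Subset n) →
    (∀ i → Disjoint W (V i)) →
    (∀ i j → i ≢ j → Disjoint (V i) (V j)) →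
    (∀ v → v ∈ W ⊎ ∃ λ i → v ∈ V i) →
    2 ≤ r →
    (∀ i → 2 ≤ ∣ V i ∣) →
    (∀ i j → i ≢ j → PrimeInduced G (W ∪ (V i ∪ V j))) →
    Prime G
lemma6p5 G W V _ V-disjoint covers 2≤r@(s≤s _) 2≤∣V∣ piecesPrime
  (A , B , split@(_ , A∪B≡⊤ , 2≤∣A∣ , 2≤∣B∣ , _)) =
  let (i , j , i≢j , twoA , twoB) =
        balancedPiece A∪B (2≤∣p∣⇒TwoElements A 2≤∣A∣) (2≤∣p∣⇒TwoElements B 2≤∣B∣) zero
  in piecesPrime i j i≢j
       (A ∩ Piece i j , B ∩ Piece i j ,
        split-restrict {G = G} split ⊆⊤ (TwoElements⇒2≤∣p∣ twoA) (TwoElements⇒2≤∣p∣ twoB))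
  where
  open Pieces W V V-disjoint covers (λ k → 2≤∣p∣⇒TwoElements (V k) (2≤∣V∣ k))
    (anotherIndex 2≤r)

  A∪B : Covering A B
  A∪B v = x∈p∪q⁻ A B (subst (v ∈_) (sym A∪B≡⊤) ∈⊤)
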